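{- Let $m$ be a positive integer, and let $m=m_1+m_2+\cdots+m_e$ be any partition of $m$ into positive integers with $1\le m_1\le m_2\le\cdots\le m_e\le m$. Then there exist a positive integer $k$ and positive integers $n_1,\dots,n_k$ such that $$m=\frac{1}{n_1}+\frac{1}{n_2}+\cdots+\frac{1}{n_k}$$ and $$\Omega\{n_1,\dots,n_k\}=\Big\{\sum_{i\in S} m_i : S\subseteq\{1,\dots,e\}\Big\},$$ where $$\Omega\{n_1,\dots,n_k\}=\Big\{\sum_{i\in I}\frac{1}{n_i} : I\subseteq\{1,\dots,k\}\Big\}\cap\mathbb{Z}.$$ Moreover, the $n_i$ can be chosen so that in addition $$\Big|\Big\{I\subseteq\{1,\dots,k\} : \sum_{i\in I}\frac{1}{n_i}\in\mathbb{Z}\Big\}\Big|=2^e.$$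
   Context: The empty sum (for $S=\emptyset$ or $I=\emptyset$) is taken to be $0$. -}

module Defs where

open import Data.Nat using (ℕ; zero; suc)
import Data.Nat as ℕ
open import Data.Integer using (+_)
open import Data.Rational using (ℚ; _/_; 0ℚ)
import Data.Rational as ℚ
open import Data.Fin using (Fin)
import Data.Fin as Fin
open import Data.Fin.Subset using (Subset)
open import Data.Vec using ([]; _∷_)
open import Data.Bool using (true; false)
open import Relation.Binary.PropositionalEquality using (_≡_)

ℕtoℚ : ℕ → ℚ
ℕtoℚ n = + n / 1

-- unit fraction 1/n (only used for n ≥ 1; the value at 0 is an irrelevant junk value 0)
recip : ℕ → ℚ
recip zero    = 0ℚ
recip (suc d) = + 1 / suc d

sumℚ : ∀ {k} → Subset k → (Fin k → ℚ) → ℚ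
sumℚ []          f = 0ℚ
sumℚ (true  ∷ I) f = f Fin.zero ℚ.+ sumℚ I (λ i → f (Fin.suc i))
sumℚ (false ∷ I) f = sumℚ I (λ i → f (Fin.suc i))

sumℕ : ∀ {e} → Subset e → (Fin e → ℕ) → ℕ
sumℕ []          f = 0
sumℕ (true  ∷ S) f = f Fin.zero ℕ.+ sumℕ S (λ i → f (Fin.suc i))
sumℕ (false ∷ S) f = sumℕ S (λ i → f (Fin.suc i))

IsInt : ℚ → Set
IsInt q = ℚ.ℚ.denominatorℕ q ≡ 1

-- Integrality of a subsum is a divisibility condition on numerators over a common
-- denominator, and numerators over pairwise coprime denominators can only be divisible
-- summand by summand. For each part M = m_i one builds a block of unit fractions with sum
-- exactly M whose only integral subsums are 0 and M: starting from the empty family and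
-- repeatedly adjoining R P copies of 1/(R P + 1), where P is the current common
-- denominator, gives families with sum i - A/P, P = 1 + R A, whose only integral subsum
-- is the empty one; a last group of copies brings the sum to M - 1/D, and adjoining 1/D
-- gives the block. Its common denominator is ≡ 1 modulo the freely chosen R, so choosing R
-- as a multiple of the denominators already used makes the common denominators of the
-- blocks pairwise coprime. The integral subsums of the union are then exactly the unions
-- of whole blocks.
module Submission where

open import Defs
open import Data.Bool using (Bool; true; false; not)
open import Data.Empty using (⊥-elim)
open import Data.Fin using (Fin)
import Data.Fin as Fin
import Data.Fin.Properties as FinP
open import Data.Fin.Subset using (Subset; ⊤; ⊥; ∁) renaming (∣_∣ to card)
open import Data.Fin.Subset.Properties using (∣p∣≤n; ∣⊥∣≡0; ∣⊤∣≡n; ∣∁p∣≡n∸∣p∣)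
open import Data.Integer using (+_)
import Data.Integer as ℤ
import Data.Integer.Properties as ℤP
open import Data.Nat using (ℕ; zero; suc; _+_; _*_; _^_; _≤_; _<_; z≤n; s≤s; NonZero)
open import Data.Nat.Properties
  using (≤-refl; ≤-trans; <⇒≱; ≡-irrelevant; m≤n*m; m+[n∸m]≡n; n≢0⇒n>0; n>0⇒n≢0; m*n≢0; *-zeroʳ; *-identityʳ; *-assoc; *-comm; +-comm; +-suc; m*n≡1⇒m≡1)
open import Data.Nat.Divisibility
  using (_∣_; ∣-trans; ∣1⇒≡1; ∣m+n∣m⇒∣n; n∣m*n; ∣m⇒∣m*n; ∣⇒≤; m*n∣⇒m∣; m*n∣⇒n∣)
open import Data.Nat.Coprimality using (Coprime; coprime-divisor)
import Data.Nat.Coprimality as Coprime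
open import Data.Nat.GCD using (gcd; gcd[m,n]∣m)
open import Data.Nat.Tactic.RingSolver using (solve-∀)
open import Data.Product using (Σ; ∃; _×_; _,_; proj₁; proj₂)
open import Data.Product.Function.NonDependent.Propositional using (_×-↔_)
open import Data.Rational using (ℚ; _/_; toℚᵘ)
import Data.Rational as ℚ
import Data.Rational.Properties as ℚP
import Data.Rational.Unnormalised as ℚᵘ
import Data.Rational.Unnormalised.Properties as ℚᵘP
open import Data.Sum using (_⊎_; inj₁; inj₂)
open import Data.Vec using (Vec; []; _∷_; _++_; lookup; replicate; take; drop; tail)
open import Data.Vec.Properties using (take++drop≡id; ++-injectiveˡ; ++-injectiveʳ; map-++)
open import Data.Vec.Relation.Unary.All using (All; []; _∷_)
import Data.Vec.Relation.Unary.All.Properties as All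
open import Function using (_∘_)
open import Function.Bundles using (_⇔_; _↔_; mk⇔; mk↔ₛ′)
open import Function.Definitions using (Injective)
open import Function.Properties.Inverse using (↔-trans; ↔-sym)
open import Relation.Binary.PropositionalEquality

/-≡-cross : ∀ a b d₁ d₂ → a * suc d₂ ≡ b * suc d₁ → + a / suc d₁ ≡ + b / suc d₂
/-≡-cross a b d₁ d₂ eq = ℚP.fromℚᵘ-cong {ℚᵘ.mkℚᵘ (+ a) d₁} {ℚᵘ.mkℚᵘ (+ b) d₂} (ℚᵘ.*≡* (begin
  + a ℤ.* + suc d₂  ≡⟨ ℤP.pos-* a (suc d₂) ⟨
  + (a * suc d₂)    ≡⟨ cong +_ eq ⟩
  + (b * suc d₁)    ≡⟨ ℤP.pos-* b (suc d₁) ⟩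
  + b ℤ.* + suc d₁  ∎))
  where open ≡-Reasoning

/-+-/ : ∀ a b d₁ d₂ → + a / suc d₁ ℚ.+ + b / suc d₂ ≡ + (a * suc d₂ + b * suc d₁) / (suc d₁ * suc d₂)
/-+-/ a b d₁ d₂ = ℚP.toℚᵘ-injective (begin
  toℚᵘ (+ a / suc d₁ ℚ.+ + b / suc d₂)                ≈⟨ ℚP.toℚᵘ-homo-+ (+ a / suc d₁) (+ b / suc d₂) ⟩
  toℚᵘ (+ a / suc d₁) ℚᵘ.+ toℚᵘ (+ b / suc d₂)        ≈⟨ ℚᵘP.+-cong (ℚP.toℚᵘ-fromℚᵘ (ℚᵘ.mkℚᵘ (+ a) d₁)) (ℚP.toℚᵘ-fromℚᵘ (ℚᵘ.mkℚᵘ (+ b) d₂)) ⟩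
  ℚᵘ.mkℚᵘ (+ a) d₁ ℚᵘ.+ ℚᵘ.mkℚᵘ (+ b) d₂              ≡⟨ cong (λ n → ℚᵘ.mkℚᵘ n (d₂ + d₁ * suc d₂)) numerator ⟩
  ℚᵘ.mkℚᵘ (+ (a * suc d₂ + b * suc d₁)) (d₂ + d₁ * suc d₂) ≈⟨ ℚP.toℚᵘ-fromℚᵘ (ℚᵘ.mkℚᵘ (+ (a * suc d₂ + b * suc d₁)) (d₂ + d₁ * suc d₂)) ⟨
  toℚᵘ (+ (a * suc d₂ + b * suc d₁) / (suc d₁ * suc d₂)) ∎)
  where
  open ℚᵘP.≃-Reasoning
  numerator : + a ℤ.* + suc d₂ ℤ.+ + b ℤ.* + suc d₁ ≡ + (a * suc d₂ + b * suc d₁)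
  numerator = sym (trans (ℤP.pos-+ (a * suc d₂) (b * suc d₁)) (cong₂ ℤ._+_ (ℤP.pos-* a (suc d₂)) (ℤP.pos-* b (suc d₁))))

/-+-/-same : ∀ a b d → + a / suc d ℚ.+ + b / suc d ≡ + (a + b) / suc d
/-+-/-same a b d = trans (/-+-/ a b d d) (/-≡-cross (a * suc d + b * suc d) (a + b) (d + d * suc d) d (cross a b (suc d)))
  where
  cross : ∀ a b D → (a * D + b * D) * D ≡ (a + b) * (D * D)
  cross = solve-∀

IsInt-/⇒∣ : ∀ a d → IsInt (+ a / suc d) → suc d ∣ a
IsInt-/⇒∣ a d isInt = subst (_∣ a) gcd≡ (gcd[m,n]∣m a (suc d))
  where
  gcd≡ : gcd a (suc d) ≡ suc d
  gcd≡ = ℤP.+-injective (begin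
    + gcd a (suc d)                                    ≡⟨ ℤP.*-identityˡ _ ⟨
    + 1 ℤ.* + gcd a (suc d)                            ≡⟨ cong (λ n → + n ℤ.* + gcd a (suc d)) isInt ⟨
    ℚ.↧ (+ a / suc d) ℤ.* + gcd a (suc d)              ≡⟨ ℚP.↧-/ (+ a) (suc d) ⟩
    + suc d                                            ∎)
    where open ≡-Reasoning

IsInt-ℕtoℚ : ∀ a → IsInt (ℕtoℚ a)
IsInt-ℕtoℚ a = m*n≡1⇒m≡1 d (gcd a 1) (ℤP.+-injective (trans (ℤP.pos-* d (gcd a 1)) (ℚP.↧-/ (+ a) 1)))
  where d = ℚ.ℚ.denominatorℕ (ℕtoℚ a)

∣⇒coprime-suc : ∀ {x y} → x ∣ y → Coprime x (suc y)
∣⇒coprime-suc {x} {y} x∣y {d} (d∣x , d∣1+y) =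
  ∣1⇒≡1 (∣m+n∣m⇒∣n (subst (d ∣_) (+-comm 1 y) d∣1+y) (∣-trans d∣x x∣y))

coprime-1+R*a : ∀ R a → Coprime (suc (R * a)) (suc (R * suc a))
coprime-1+R*a R a {d} (d∣1+Ra , d∣1+R[1+a]) = ∣1⇒≡1 (∣m+n∣m⇒∣n d∣Ra+1 (∣m⇒∣m*n a d∣R))
  where
  d∣Ra+1 : d ∣ R * a + 1
  d∣Ra+1 = subst (d ∣_) (+-comm 1 (R * a)) d∣1+Ra
  expand : ∀ R a → suc (R * suc a) ≡ suc (R * a) + R
  expand = solve-∀
  d∣R : d ∣ R
  d∣R = ∣m+n∣m⇒∣n (subst (d ∣_) (expand R a) d∣1+R[1+a]) d∣1+Ra

coprime-*∣-cross⇒∣ : ∀ D₁ D₂ a b → Coprime D₁ D₂ → D₁ * D₂ ∣ a * D₂ + b * D₁ → (D₁ ∣ a) × (D₂ ∣ b)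
coprime-*∣-cross⇒∣ D₁ D₂ a b cop D₁D₂∣ = D₁∣a , D₂∣b
  where
  D₁∣a : D₁ ∣ a
  D₁∣a = coprime-divisor cop (subst (D₁ ∣_) (*-comm a D₂)
    (∣m+n∣m⇒∣n (subst (D₁ ∣_) (+-comm (a * D₂) (b * D₁)) (m*n∣⇒m∣ D₁ D₂ D₁D₂∣)) (n∣m*n b)))
  D₂∣b : D₂ ∣ b
  D₂∣b = coprime-divisor (Coprime.sym cop) (subst (D₂ ∣_) (*-comm b D₁)
    (∣m+n∣m⇒∣n (m*n∣⇒n∣ D₁ D₂ D₁D₂∣) (n∣m*n a)))

_≡1-mod_ : ℕ → ℕ → Set
x ≡1-mod R = ∃ λ t → x ≡ suc (R * t)

≡1-mod-* : ∀ {R x y} → x ≡1-mod R → y ≡1-mod R → (x * y) ≡1-mod R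
≡1-mod-* {R} (s , refl) (t , refl) = s + t + R * s * t , expand R s t
  where
  expand : ∀ R s t → suc (R * s) * suc (R * t) ≡ suc (R * (s + t + R * s * t))
  expand = solve-∀

≡1-mod-*⇒≡1-mod : ∀ {R Q x} → x ≡1-mod (R * Q) → x ≡1-mod R
≡1-mod-*⇒≡1-mod {R} {Q} (t , refl) = Q * t , cong suc (*-assoc R Q t)

≡1-mod-*⇒coprime : ∀ {R Q x} → x ≡1-mod (R * Q) → Coprime Q x
≡1-mod-*⇒coprime {R} {Q} (t , refl) = ∣⇒coprime-suc (∣m⇒∣m*n t (n∣m*n R))

replicate-++ : ∀ {A : Set} m {n} (x : A) → replicate (m + n) x ≡ replicate m x ++ replicate n x
replicate-++ zero    x = refl
replicate-++ (suc m) x = cong (x ∷_) (replicate-++ m x)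

take-++ : ∀ {A : Set} {m n} (xs : Vec A m) (ys : Vec A n) → take m (xs ++ ys) ≡ xs
take-++ {m = m} xs ys = ++-injectiveˡ _ xs (take++drop≡id m (xs ++ ys))

drop-++ : ∀ {A : Set} {m n} (xs : Vec A m) (ys : Vec A n) → drop m (xs ++ ys) ≡ ys
drop-++ {m = m} xs ys = ++-injectiveʳ _ xs (take++drop≡id m (xs ++ ys))

⊥-++ : ∀ m {n} → ⊥ {m + n} ≡ ⊥ {m} ++ ⊥ {n}
⊥-++ m = replicate-++ m false

⊤-++ : ∀ m {n} → ⊤ {m + n} ≡ ⊤ {m} ++ ⊤ {n}
⊤-++ m = replicate-++ m true

∀-++ : ∀ {A : Set} {m n} (P : Vec A (m + n) → Set) → (∀ xs ys → P (xs ++ ys)) → ∀ zs → P zs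
∀-++ {m = m} P P++ zs = subst P (take++drop≡id m zs) (P++ (take m zs) (drop m zs))

∣p∣≡0⇒p≡⊥ : ∀ {n} (p : Subset n) → card p ≡ 0 → p ≡ ⊥
∣p∣≡0⇒p≡⊥ []          _  = refl
∣p∣≡0⇒p≡⊥ (false ∷ p) eq = cong (false ∷_) (∣p∣≡0⇒p≡⊥ p eq)

∁p≡⊥⇒p≡⊤ : ∀ {n} (p : Subset n) → ∁ p ≡ ⊥ → p ≡ ⊤
∁p≡⊥⇒p≡⊤ []         _  = refl
∁p≡⊥⇒p≡⊤ (true ∷ p) eq = cong (true ∷_) (∁p≡⊥⇒p≡⊤ p (cong tail eq))

card[p]+card[∁p]≡n : ∀ {n} (p : Subset n) → card p + card (∁ p) ≡ n
card[p]+card[∁p]≡n p = trans (cong (_+_ (card p)) (∣∁p∣≡n∸∣p∣ p)) (m+[n∸m]≡n (∣p∣≤n p))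

Subset0-unique : ∀ {n} → n ≡ 0 → (p q : Subset n) → p ≡ q
Subset0-unique refl [] [] = refl

Subset↔Fin[2^n] : ∀ n → Subset n ↔ Fin (2 ^ n)
Subset↔Fin[2^n] zero    = mk↔ₛ′ (λ _ → Fin.zero) (λ _ → []) (λ { Fin.zero → refl ; (Fin.suc ()) }) (λ { [] → refl })
Subset↔Fin[2^n] (suc n) =
  ↔-trans uncons (↔-trans (↔-sym FinP.2↔Bool ×-↔ Subset↔Fin[2^n] n) (↔-sym FinP.*↔×))
  where
  uncons : Subset (suc n) ↔ (Bool × Subset n)
  uncons = mk↔ₛ′ (λ { (b ∷ p) → b , p }) (λ (b , p) → b ∷ p) (λ _ → refl) (λ { (_ ∷ _) → refl })

unitSum : ∀ {k} → Vec ℕ k → Subset k → ℚ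
unitSum ns I = sumℚ I (λ i → recip (lookup ns i))

unitSum-++ : ∀ {m n} (ns : Vec ℕ m) (ns′ : Vec ℕ n) J K →
             unitSum (ns ++ ns′) (J ++ K) ≡ unitSum ns J ℚ.+ unitSum ns′ K
unitSum-++ []       ns′ []          K = sym (ℚP.+-identityˡ _)
unitSum-++ (n ∷ ns) ns′ (true ∷ J)  K =
  trans (cong (recip n ℚ.+_) (unitSum-++ ns ns′ J K)) (sym (ℚP.+-assoc (recip n) _ _))
unitSum-++ (n ∷ ns) ns′ (false ∷ J) K = unitSum-++ ns ns′ J K

-- The common denominator is stored as its predecessor so that _/_ finds its NonZero instance.
record UnitFamily : Set where
  field
    size             : ℕ
    denominators     : Vec ℕ size
    denominators-pos : All (1 ≤_) denominators
    den-1            : ℕ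
    num              : Subset size → ℕ
    unitSum≡num/den  : ∀ I → unitSum denominators I ≡ + num I / suc den-1

  den : ℕ
  den = suc den-1

open UnitFamily

∅ : UnitFamily
∅ = record
  { size = 0 ; denominators = [] ; denominators-pos = [] ; den-1 = 0 ; num = λ _ → 0
  ; unitSum≡num/den = λ { [] → refl } }

copies : ℕ → ℕ → UnitFamily
copies μ c = record
  { size = c ; denominators = replicate c (suc μ) ; denominators-pos = pos c ; den-1 = μ
  ; num = card ; unitSum≡num/den = sum c }
  where
  pos : ∀ c → All (1 ≤_) (replicate c (suc μ))
  pos zero    = []
  pos (suc c) = s≤s z≤n ∷ pos c
  sum : ∀ c (I : Subset c) → unitSum (replicate c (suc μ)) I ≡ + card I / suc μ
  sum zero    []          = /-≡-cross 0 0 0 μ refl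
  sum (suc c) (true ∷ I)  = trans (cong (recip (suc μ) ℚ.+_) (sum c I)) (/-+-/-same 1 (card I) μ)
  sum (suc c) (false ∷ I) = sum c I

num-⊕ : (S T : UnitFamily) → Subset (size S + size T) → ℕ
num-⊕ S T I = num S (take (size S) I) * den T + num T (drop (size S) I) * den S

num-⊕-++ : ∀ S T J K → num-⊕ S T (J ++ K) ≡ num S J * den T + num T K * den S
num-⊕-++ S T J K = cong₂ (λ J K → num S J * den T + num T K * den S) (take-++ J K) (drop-++ J K)

_⊕_ : UnitFamily → UnitFamily → UnitFamily
S ⊕ T = record
  { size = size S + size T
  ; denominators = denominators S ++ denominators T
  ; denominators-pos = All.++⁺ (denominators-pos S) (denominators-pos T)
  ; den-1 = den-1 T + den-1 S * den T
  ; num = num-⊕ S T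
  ; unitSum≡num/den = ∀-++ (λ I → unitSum (denominators S ++ denominators T) I ≡ + num-⊕ S T I / (den S * den T)) sum }
  where
  sum : ∀ J K → unitSum (denominators S ++ denominators T) (J ++ K) ≡ + num-⊕ S T (J ++ K) / (den S * den T)
  sum J K = begin
    unitSum (denominators S ++ denominators T) (J ++ K)       ≡⟨ unitSum-++ (denominators S) (denominators T) J K ⟩
    unitSum (denominators S) J ℚ.+ unitSum (denominators T) K ≡⟨ cong₂ ℚ._+_ (unitSum≡num/den S J) (unitSum≡num/den T K) ⟩
    + num S J / den S ℚ.+ + num T K / den T                   ≡⟨ /-+-/ (num S J) (num T K) (den-1 S) (den-1 T) ⟩
    + (num S J * den T + num T K * den S) / (den S * den T)   ≡⟨ cong (λ n → + n / (den S * den T)) (num-⊕-++ S T J K) ⟨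
    + num-⊕ S T (J ++ K) / (den S * den T)                    ∎
    where open ≡-Reasoning

num-⊕-⊤ : ∀ S T → num (S ⊕ T) ⊤ ≡ num S ⊤ * den T + num T ⊤ * den S
num-⊕-⊤ S T = trans (cong (num-⊕ S T) (⊤-++ (size S))) (num-⊕-++ S T ⊤ ⊤)

adjoin-1/den : UnitFamily → UnitFamily
adjoin-1/den G = record
  { size = suc (size G) ; denominators = den G ∷ denominators G
  ; denominators-pos = s≤s z≤n ∷ denominators-pos G ; den-1 = den-1 G
  ; num = num′ ; unitSum≡num/den = sum }
  where
  num′ : Subset (suc (size G)) → ℕ
  num′ (true  ∷ J) = suc (num G J)
  num′ (false ∷ J) = num G J
  sum : ∀ I → unitSum (den G ∷ denominators G) I ≡ + num′ I / den G
  sum (true  ∷ J) = trans (cong (recip (den G) ℚ.+_) (unitSum≡num/den G J)) (/-+-/-same 1 (num G J) (den-1 G))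
  sum (false ∷ J) = unitSum≡num/den G J

Additive : UnitFamily → Set
Additive S = num S ⊥ ≡ 0 × (∀ I → num S I + num S (∁ I) ≡ num S ⊤)

OnlyEmptyIntegral : UnitFamily → Set
OnlyEmptyIntegral S = ∀ I → den S ∣ num S I → I ≡ ⊥

OnlyTrivialIntegral : ℕ → UnitFamily → Set
OnlyTrivialIntegral M S =
  num S ⊤ ≡ M * den S × num S ⊥ ≡ 0 × (∀ I → den S ∣ num S I → I ≡ ⊥ ⊎ I ≡ ⊤)

copies-additive : ∀ μ c → Additive (copies μ c)
copies-additive μ c = ∣⊥∣≡0 c , λ I → trans (card[p]+card[∁p]≡n I) (sym (∣⊤∣≡n c))

copies-onlyEmptyIntegral : ∀ μ c → c ≤ μ → OnlyEmptyIntegral (copies μ c)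
copies-onlyEmptyIntegral μ c c≤μ I 1+μ∣∣I∣ =
  ∣p∣≡0⇒p≡⊥ I (∣∧<⇒≡0 (card I) 1+μ∣∣I∣ (s≤s (≤-trans (∣p∣≤n I) c≤μ)))
  where
  ∣∧<⇒≡0 : ∀ x → suc μ ∣ x → x < suc μ → x ≡ 0
  ∣∧<⇒≡0 zero    _    _     = refl
  ∣∧<⇒≡0 (suc x) 1+μ∣ x<1+μ = ⊥-elim (<⇒≱ x<1+μ (∣⇒≤ 1+μ∣))

⊕-additive : ∀ S T → Additive S → Additive T → Additive (S ⊕ T)
⊕-additive S T (S⊥ , S∁) (T⊥ , T∁) = num-⊥ , ∀-++ (λ I → num (S ⊕ T) I + num (S ⊕ T) (∁ I) ≡ num (S ⊕ T) ⊤) num-∁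
  where
  num-⊥ : num (S ⊕ T) ⊥ ≡ 0
  num-⊥ rewrite ⊥-++ (size S) {size T} | num-⊕-++ S T ⊥ ⊥ | S⊥ | T⊥ = refl
  regroup : ∀ a b a′ b′ x y → (a * x + b * y) + (a′ * x + b′ * y) ≡ (a + a′) * x + (b + b′) * y
  regroup = solve-∀
  num-∁ : ∀ J K → num (S ⊕ T) (J ++ K) + num (S ⊕ T) (∁ (J ++ K)) ≡ num (S ⊕ T) ⊤
  num-∁ J K = begin
    num-⊕ S T (J ++ K) + num-⊕ S T (∁ (J ++ K))
      ≡⟨ cong₂ _+_ (num-⊕-++ S T J K) (trans (cong (num-⊕ S T) (map-++ not J K)) (num-⊕-++ S T (∁ J) (∁ K))) ⟩
    (num S J * den T + num T K * den S) + (num S (∁ J) * den T + num T (∁ K) * den S)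
      ≡⟨ regroup (num S J) (num T K) (num S (∁ J)) (num T (∁ K)) (den T) (den S) ⟩
    (num S J + num S (∁ J)) * den T + (num T K + num T (∁ K)) * den S
      ≡⟨ cong₂ (λ u v → u * den T + v * den S) (S∁ J) (T∁ K) ⟩
    num S ⊤ * den T + num T ⊤ * den S
      ≡⟨ num-⊕-⊤ S T ⟨
    num (S ⊕ T) ⊤ ∎
    where open ≡-Reasoning

⊕-onlyEmptyIntegral : ∀ S T → Coprime (den S) (den T) →
                      OnlyEmptyIntegral S → OnlyEmptyIntegral T → OnlyEmptyIntegral (S ⊕ T)
⊕-onlyEmptyIntegral S T cop S∅ T∅ = ∀-++ (λ I → den (S ⊕ T) ∣ num (S ⊕ T) I → I ≡ ⊥) integral
  where
  integral : ∀ J K → den (S ⊕ T) ∣ num (S ⊕ T) (J ++ K) → J ++ K ≡ ⊥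
  integral J K den∣ =
    let dS∣ , dT∣ = coprime-*∣-cross⇒∣ (den S) (den T) (num S J) (num T K) cop
                      (subst (den S * den T ∣_) (num-⊕-++ S T J K) den∣)
    in trans (cong₂ _++_ (S∅ J dS∣) (T∅ K dT∣)) (sym (⊥-++ (size S)))

-- Since num G I + num G (∁ I) = M * den G - 1, adding 1 to one side makes the other divisible.
adjoin-1/den-onlyTrivialIntegral : ∀ M G → Additive G → OnlyEmptyIntegral G →
  suc (num G ⊤) ≡ M * den G → OnlyTrivialIntegral M (adjoin-1/den G)
adjoin-1/den-onlyTrivialIntegral M G (G⊥ , G∁) G∅ total = total , G⊥ , integral
  where
  integral : ∀ I → den G ∣ num (adjoin-1/den G) I → I ≡ ⊥ ⊎ I ≡ ⊤
  integral (false ∷ J) den∣ = inj₁ (cong (false ∷_) (G∅ J den∣))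
  integral (true  ∷ J) den∣ = inj₂ (cong (true ∷_) (∁p≡⊥⇒p≡⊤ J (G∅ (∁ J) den∣num∁J)))
    where
    den∣num∁J : den G ∣ num G (∁ J)
    den∣num∁J = ∣m+n∣m⇒∣n (subst (den G ∣_) (sym (trans (cong suc (G∁ J)) total)) (n∣m*n M)) den∣

-- Blocks

record Stage (R i : ℕ) : Set where
  field
    family            : UnitFamily
    deficit           : ℕ
    den≡              : suc (R * deficit) ≡ den family
    num⊤+deficit      : num family ⊤ + deficit ≡ i * den family
    additive          : Additive family
    onlyEmptyIntegral : OnlyEmptyIntegral family

stage : ∀ R i → Stage R i
stage R zero = record
  { family = ∅ ; deficit = 0 ; den≡ = cong suc (*-zeroʳ R) ; num⊤+deficit = refl
  ; additive = refl , (λ _ → refl) ; onlyEmptyIntegral = λ { [] _ → refl } }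
stage R (suc i) = record
  { family = S ⊕ g
  ; deficit = A * q + P
  ; den≡ = subst (λ P → suc (R * (A * suc (R * P) + P)) ≡ P * suc (R * P)) den≡ (den-identity R A)
  ; num⊤+deficit = num⊤
  ; additive = ⊕-additive S g additive (copies-additive (R * P) (R * P))
  ; onlyEmptyIntegral = ⊕-onlyEmptyIntegral S g (∣⇒coprime-suc (n∣m*n R))
      onlyEmptyIntegral (copies-onlyEmptyIntegral (R * P) (R * P) ≤-refl) }
  where
  open Stage (stage R i) renaming (family to S; deficit to A)
  P = den S
  q = suc (R * P)
  g = copies (R * P) (R * P)
  den-identity : ∀ R A → suc (R * (A * suc (R * suc (R * A)) + suc (R * A))) ≡ suc (R * A) * suc (R * suc (R * A))
  den-identity = solve-∀
  regroup : ∀ N A P R → (N * suc (R * P) + R * P * P) + (A * suc (R * P) + P) ≡ (N + A) * suc (R * P) + P * suc (R * P)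
  regroup = solve-∀
  collect : ∀ i P q → i * P * q + P * q ≡ suc i * (P * q)
  collect = solve-∀
  num⊤ : num (S ⊕ g) ⊤ + (A * q + P) ≡ suc i * (P * q)
  num⊤ = begin
    num (S ⊕ g) ⊤ + (A * q + P)             ≡⟨ cong (_+ (A * q + P)) (num-⊕-⊤ S g) ⟩
    (num S ⊤ * q + card (⊤ {R * P}) * P) + (A * q + P) ≡⟨ cong (λ c → (num S ⊤ * q + c * P) + (A * q + P)) (∣⊤∣≡n (R * P)) ⟩
    (num S ⊤ * q + R * P * P) + (A * q + P)  ≡⟨ regroup (num S ⊤) A P R ⟩
    (num S ⊤ + A) * q + P * q                ≡⟨ cong (λ x → x * q + P * q) num⊤+deficit ⟩
    i * P * q + P * q                        ≡⟨ collect i P q ⟩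
    suc i * (P * q)                          ∎
    where open ≡-Reasoning

record Block (M R : ℕ) : Set where
  field
    family            : UnitFamily
    additive          : Additive family
    onlyEmptyIntegral : OnlyEmptyIntegral family
    num⊤              : suc (num family ⊤) ≡ M * den family
    den≡1-mod         : den family ≡1-mod R

-- A stage has sum M - (1 + a)/P with P = 1 + R (1 + a); adding a copies of 1/(1 + R a)
-- leaves M - 1/((1 + R a) P), because (1 + a)(1 + R a) - a P = 1.
stage⇒block : ∀ {M R a} .{{_ : NonZero R}} (C : Stage R M) → Stage.deficit C ≡ suc a → Block M R
stage⇒block {M} {R} {a} C deficit≡ = record
  { family = G
  ; additive = ⊕-additive g S (copies-additive (R * a) a) additive
  ; onlyEmptyIntegral = ⊕-onlyEmptyIntegral g S coprime
      (copies-onlyEmptyIntegral (R * a) a (m≤n*m a R)) onlyEmptyIntegral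
  ; num⊤ = num⊤
  ; den≡1-mod = ≡1-mod-* {R} (a , refl) (deficit , sym den≡) }
  where
  open Stage C
  S = family
  P = den S
  z = suc (R * a)
  g = copies (R * a) a
  G = g ⊕ S
  P≡ : P ≡ suc (R * suc a)
  P≡ = trans (sym den≡) (cong (λ A → suc (R * A)) deficit≡)
  coprime : Coprime z P
  coprime = subst (Coprime z) (sym P≡) (coprime-1+R*a R a)
  cancel : ∀ R a N → suc (a * suc (R * suc a) + N * suc (R * a)) ≡ (N + suc a) * suc (R * a)
  cancel = solve-∀
  num⊤ : suc (num G ⊤) ≡ M * (z * P)
  num⊤ = begin
    suc (num G ⊤)                          ≡⟨ cong suc (num-⊕-⊤ g S) ⟩
    suc (card (⊤ {a}) * P + num S ⊤ * z)   ≡⟨ cong (λ c → suc (c * P + num S ⊤ * z)) (∣⊤∣≡n a) ⟩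
    suc (a * P + num S ⊤ * z)              ≡⟨ cong (λ P → suc (a * P + num S ⊤ * z)) P≡ ⟩
    suc (a * suc (R * suc a) + num S ⊤ * z) ≡⟨ cancel R a (num S ⊤) ⟩
    (num S ⊤ + suc a) * z                  ≡⟨ cong (λ A → (num S ⊤ + A) * z) deficit≡ ⟨
    (num S ⊤ + deficit) * z                ≡⟨ cong (_* z) num⊤+deficit ⟩
    M * P * z                              ≡⟨ trans (*-assoc M P z) (cong (M *_) (*-comm P z)) ⟩
    M * (z * P)                            ∎
    where open ≡-Reasoning

block : ∀ {M R} .{{_ : NonZero R}} → 1 ≤ M → Block M R
block {suc M} {R} _ = stage⇒block (stage R (suc M)) (+-suc _ _)

-- Assembling the blocks

record Realisation {e} (mi : Fin e → ℕ) : Set where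
  field
    family            : UnitFamily
    embed             : Subset e → Subset (size family)
    num-embed         : ∀ S → num family (embed S) ≡ sumℕ S mi * den family
    integral⇒embedded : ∀ I → den family ∣ num family I → ∃ λ S → embed S ≡ I
    embed-injective   : Injective _≡_ _≡_ embed
    embed-⊤           : embed ⊤ ≡ ⊤

realisation-[] : (mi : Fin 0 → ℕ) → Realisation mi
realisation-[] mi = record
  { family = ∅ ; embed = λ _ → [] ; num-embed = λ { [] → refl }
  ; integral⇒embedded = λ { [] _ → [] , refl } ; embed-injective = λ { {[]} {[]} _ → refl } ; embed-⊤ = refl }

allOrNone : ∀ {n} → Bool → Subset n
allOrNone true  = ⊤
allOrNone false = ⊥

allOrNone-injective : ∀ {n} → Injective _≡_ _≡_ (allOrNone {suc n})
allOrNone-injective {x = true}  {true}  _  = refl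
allOrNone-injective {x = false} {false} _  = refl
allOrNone-injective {x = true}  {false} ()
allOrNone-injective {x = false} {true}  ()

module ∷-Realisation {e} {mi : Fin (suc e) → ℕ} (G : UnitFamily)
  (trivial : OnlyTrivialIntegral (mi Fin.zero) (adjoin-1/den G))
  (r : Realisation (mi ∘ Fin.suc)) (coprime : Coprime (den G) (den (Realisation.family r))) where

  open Realisation r renaming (family to F)

  B : UnitFamily
  B = adjoin-1/den G

  embed′ : Subset (suc e) → Subset (size B + size F)
  embed′ (b ∷ S) = allOrNone b ++ embed S

  num-embed′ : ∀ S → num (B ⊕ F) (embed′ S) ≡ sumℕ S mi * (den B * den F)
  num-embed′ (true ∷ S) = begin
    num-⊕ B F (⊤ ++ embed S)                     ≡⟨ num-⊕-++ B F ⊤ (embed S) ⟩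
    num B ⊤ * den F + num F (embed S) * den B   ≡⟨ cong₂ (λ x y → x * den F + y * den B) (proj₁ trivial) (num-embed S) ⟩
    mi Fin.zero * den B * den F + sumℕ S (mi ∘ Fin.suc) * den F * den B
                                                ≡⟨ collect (mi Fin.zero) (den B) (sumℕ S (mi ∘ Fin.suc)) (den F) ⟩
    (mi Fin.zero + sumℕ S (mi ∘ Fin.suc)) * (den B * den F) ∎
    where
    open ≡-Reasoning
    collect : ∀ M Q T D → M * Q * D + T * D * Q ≡ (M + T) * (Q * D)
    collect = solve-∀
  num-embed′ (false ∷ S) = begin
    num-⊕ B F (⊥ ++ embed S)                     ≡⟨ num-⊕-++ B F ⊥ (embed S) ⟩
    num B ⊥ * den F + num F (embed S) * den B   ≡⟨ cong₂ (λ x y → x * den F + y * den B) (proj₁ (proj₂ trivial)) (num-embed S) ⟩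
    sumℕ S (mi ∘ Fin.suc) * den F * den B       ≡⟨ reorder (sumℕ S (mi ∘ Fin.suc)) (den F) (den B) ⟩
    sumℕ S (mi ∘ Fin.suc) * (den B * den F)     ∎
    where
    open ≡-Reasoning
    reorder : ∀ T D Q → T * D * Q ≡ T * (Q * D)
    reorder = solve-∀

  allOrNone-⊎ : ∀ {J : Subset (size B)} → J ≡ ⊥ ⊎ J ≡ ⊤ → ∃ λ b → allOrNone b ≡ J
  allOrNone-⊎ (inj₁ J≡⊥) = false , sym J≡⊥
  allOrNone-⊎ (inj₂ J≡⊤) = true , sym J≡⊤

  integral⇒embedded′ : ∀ J K → den (B ⊕ F) ∣ num (B ⊕ F) (J ++ K) → ∃ λ S → embed′ S ≡ J ++ K
  integral⇒embedded′ J K den∣ =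
    let B∣ , F∣ = coprime-*∣-cross⇒∣ (den B) (den F) (num B J) (num F K) coprime
                    (subst (den B * den F ∣_) (num-⊕-++ B F J K) den∣)
        b , b≡ = allOrNone-⊎ (proj₂ (proj₂ trivial) J B∣)
        S , S≡ = integral⇒embedded K F∣
    in b ∷ S , cong₂ _++_ b≡ S≡

  embed′-injective : Injective _≡_ _≡_ embed′
  embed′-injective {b ∷ S} {b′ ∷ S′} eq = cong₂ _∷_
    (allOrNone-injective (++-injectiveˡ (allOrNone b) (allOrNone b′) eq))
    (embed-injective (++-injectiveʳ (allOrNone b) (allOrNone b′) eq))

  realisation : Realisation mi
  realisation = record
    { family = B ⊕ F
    ; embed = embed′
    ; num-embed = num-embed′
    ; integral⇒embedded = ∀-++ (λ I → den (B ⊕ F) ∣ num (B ⊕ F) I → ∃ λ S → embed′ S ≡ I) integral⇒embedded′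
    ; embed-injective = embed′-injective
    ; embed-⊤ = trans (cong (⊤ ++_) embed-⊤) (sym (⊤-++ (size B))) }

realise : ∀ {e} (mi : Fin e → ℕ) → (∀ i → 1 ≤ mi i) → ∀ R .{{_ : NonZero R}} →
          Σ (Realisation mi) λ r → den (Realisation.family r) ≡1-mod R
realise {zero}  mi _   R = realisation-[] mi , 0 , cong suc (sym (*-zeroʳ R))
realise {suc e} mi pos R =
  ∷-Realisation.realisation {mi = mi} G trivial rest (≡1-mod-*⇒coprime {R} rest≡1) ,
  ≡1-mod-* {R} den≡1-mod (≡1-mod-*⇒≡1-mod {R} {den G} rest≡1)
  where
  open Block (block {mi Fin.zero} {R} (pos Fin.zero)) renaming (family to G)
  trivial : OnlyTrivialIntegral (mi Fin.zero) (adjoin-1/den G)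
  trivial = adjoin-1/den-onlyTrivialIntegral (mi Fin.zero) G additive onlyEmptyIntegral num⊤
  rest-with-≡1 = realise (mi ∘ Fin.suc) (pos ∘ Fin.suc) (R * den G) {{m*n≢0 R (den G)}}
  rest = proj₁ rest-with-≡1
  rest≡1 = proj₂ rest-with-≡1

sumℕ-⊥ : ∀ {e} (f : Fin e → ℕ) → sumℕ ⊥ f ≡ 0
sumℕ-⊥ {zero}  f = refl
sumℕ-⊥ {suc e} f = sumℕ-⊥ (f ∘ Fin.suc)

module _ {e} {mi : Fin e → ℕ} (r : Realisation mi) where
  open Realisation r renaming (family to F)

  unitSum-embed : ∀ S → unitSum (denominators F) (embed S) ≡ ℕtoℚ (sumℕ S mi)
  unitSum-embed S = begin
    unitSum (denominators F) (embed S)  ≡⟨ unitSum≡num/den F (embed S) ⟩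
    + num F (embed S) / den F           ≡⟨ cong (λ n → + n / den F) (num-embed S) ⟩
    + (sumℕ S mi * den F) / den F       ≡⟨ /-≡-cross (sumℕ S mi * den F) (sumℕ S mi) (den-1 F) 0 (*-identityʳ _) ⟩
    ℕtoℚ (sumℕ S mi)                    ∎
    where open ≡-Reasoning

  IsInt⇒embedded : ∀ I → IsInt (unitSum (denominators F) I) → ∃ λ S → embed S ≡ I
  IsInt⇒embedded I isInt =
    integral⇒embedded I (IsInt-/⇒∣ (num F I) (den-1 F) (subst IsInt (unitSum≡num/den F I) isInt))

  integral-subsums : ∀ q → (IsInt q × ∃ λ I → unitSum (denominators F) I ≡ q) ⇔ (∃ λ S → q ≡ ℕtoℚ (sumℕ S mi))
  integral-subsums q = mk⇔ to from
    where
    to : (IsInt q × ∃ λ I → unitSum (denominators F) I ≡ q) → ∃ λ S → q ≡ ℕtoℚ (sumℕ S mi)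
    to (isInt , I , I≡q) with IsInt⇒embedded I (subst IsInt (sym I≡q) isInt)
    ... | S , refl = S , trans (sym I≡q) (unitSum-embed S)
    from : (∃ λ S → q ≡ ℕtoℚ (sumℕ S mi)) → IsInt q × ∃ λ I → unitSum (denominators F) I ≡ q
    from (S , refl) = IsInt-ℕtoℚ (sumℕ S mi) , embed S , unitSum-embed S

  integral-subsets↔ : (Σ (Subset (size F)) λ I → IsInt (unitSum (denominators F) I)) ↔ Subset e
  integral-subsets↔ = mk↔ₛ′ to from to∘from from∘to
    where
    to : (Σ (Subset (size F)) λ I → IsInt (unitSum (denominators F) I)) → Subset e
    to (I , isInt) = proj₁ (IsInt⇒embedded I isInt)
    from : Subset e → Σ (Subset (size F)) λ I → IsInt (unitSum (denominators F) I)
    from S = embed S , subst IsInt (sym (unitSum-embed S)) (IsInt-ℕtoℚ (sumℕ S mi))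
    to∘from : ∀ S → to (from S) ≡ S
    to∘from S = embed-injective {to (from S)} {S} (proj₂ (IsInt⇒embedded (embed S) (proj₂ (from S))))
    from∘to : ∀ x → from (to x) ≡ x
    from∘to (I , isInt) = pair-≡ (proj₂ (IsInt⇒embedded I isInt)) (proj₂ (from (to (I , isInt)))) isInt
      where
      pair-≡ : ∀ {I J} → I ≡ J → (p : IsInt (unitSum (denominators F) I)) (q : IsInt (unitSum (denominators F) J)) →
               (I , p) ≡ (J , q)
      pair-≡ {I} refl p q = cong (I ,_) (≡-irrelevant p q)

  unitSum-⊤ : unitSum (denominators F) ⊤ ≡ ℕtoℚ (sumℕ ⊤ mi)
  unitSum-⊤ = trans (cong (unitSum (denominators F)) (sym embed-⊤)) (unitSum-embed ⊤)

  size-pos : 1 ≤ sumℕ ⊤ mi → 1 ≤ size F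
  size-pos 1≤Σ = n≢0⇒n>0 λ size≡0 → n>0⇒n≢0 1≤Σ (begin
    sumℕ ⊤ mi  ≡⟨ cong (λ S → sumℕ S mi) (embed-injective (Subset0-unique size≡0 (embed ⊤) (embed ⊥))) ⟩
    sumℕ ⊥ mi  ≡⟨ sumℕ-⊥ mi ⟩
    0          ∎)
    where open ≡-Reasoning

theorem1p2 : (m : ℕ) → 1 ≤ m →
    (e : ℕ) (mi : Fin e → ℕ) →
    (∀ i → 1 ≤ mi i) → (∀ i j → i Data.Fin.≤ j → mi i ≤ mi j) → (∀ i → mi i ≤ m) →
    sumℕ ⊤ mi ≡ m →
    Σ ℕ λ k → 1 ≤ k × Σ (Fin k → ℕ) λ n →
      (∀ i → 1 ≤ n i) ×
      ℕtoℚ m ≡ sumℚ ⊤ (λ i → recip (n i)) ×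
      (∀ (q : ℚ) → ((IsInt q × ∃ λ (I : Subset k) → sumℚ I (λ i → recip (n i)) ≡ q)
                     ⇔ (∃ λ (S : Subset e) → q ≡ ℕtoℚ (sumℕ S mi)))) ×
      ((Σ (Subset k) λ I → IsInt (sumℚ I (λ i → recip (n i)))) ↔ Fin (2 ^ e))
theorem1p2 m 1≤m e mi mi-pos _ _ Σmi≡m =
  size F , size-pos r (subst (1 ≤_) (sym Σmi≡m) 1≤m) , lookup (denominators F) ,
  All.lookup⁺ (denominators-pos F) , trans (cong ℕtoℚ (sym Σmi≡m)) (sym (unitSum-⊤ r)) ,
  integral-subsums r , ↔-trans (integral-subsets↔ r) (Subset↔Fin[2^n] e)
  where
  r = proj₁ (realise mi mi-pos 1)
  F = Realisation.family r
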